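{- Let $G=(U\sqcup V,E)$ be a bipartite graph with $U=\{u_1,\dots,u_n\}$, $V=\{v_1,\dots,v_s\}$, $n\ge s$, and integer weight function $w:E\to\mathbb{Z}$; let $k\in\mathbb{Z}$ be any constant, and let $G_s,w_s$ be as defined in the context. If $N$ is a minimum weight perfect matching of $\{G_s,w_s\}$, then $M=N\cap E$ is an optimum matching of $\{G,w\}$ (a maximum cardinality matching of minimum weight among maximum cardinality matchings) which covers $V$.
   Context: Let $U'=\{u'_1,\dots,u'_n\}$ and $V'=\{v'_1,\dots,v'_s\}$ be new vertices. $G_s=(U_s\sqcup V_s,E_s)$ with $U_s=U\sqcup V'$, $V_s=V\sqcup U'$, $E_s=E\cup E_f\cup E_U$, where $E_f=\{v'_ju'_i: u_iv_j\in E\}$ and $E_U=\{u_iu'_i:1\le i\le n\}$. The weight $w_s:E_s\to\mathbb{Z}$ is $w_s(e)=w(e)$ for $e\in E$, $w_s(v'_ju'_i)=w(u_iv_j)$ for $v'_ju'_i\in E_f$, and $w_s(e)=k$ for $e\in E_U$. The weight of a matching is the sum of its edge weights. -}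

module Defs where

open import Data.Nat using (ℕ; _+_)
import Data.Nat as ℕ
open import Data.Integer as ℤ using (ℤ)
open import Data.Bool using (Bool; true; false; if_then_else_)
open import Data.Fin using (Fin; splitAt; _≟_)
open import Data.Sum using (_⊎_; inj₁; inj₂)
open import Data.List using (List; map; foldr; allFin)
open import Data.Product using (∃; _×_)
open import Relation.Binary.PropositionalEquality using (_≡_)
open import Relation.Nullary.Decidable using (⌊_⌋)

-- The weight is recorded as a total function on
-- Fin a × Fin b, but only its values on edges are ever used.
record WBipartite (a b : ℕ) : Set where
  field
    edge   : Fin a → Fin b → Bool
    weight : Fin a → Fin b → ℤ
open WBipartite public

EdgeSet : ℕ → ℕ → Set
EdgeSet a b = Fin a → Fin b → Bool

record IsMatching {a b : ℕ} (G : WBipartite a b) (M : EdgeSet a b) : Set where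
  field
    subset : ∀ i j → M i j ≡ true → edge G i j ≡ true
    uniqL  : ∀ i j j' → M i j ≡ true → M i j' ≡ true → j ≡ j'
    uniqR  : ∀ i i' j → M i j ≡ true → M i' j ≡ true → i ≡ i'

CoversRight : {a b : ℕ} → EdgeSet a b → Set
CoversRight M = ∀ j → ∃ λ i → M i j ≡ true

CoversLeft : {a b : ℕ} → EdgeSet a b → Set
CoversLeft M = ∀ i → ∃ λ j → M i j ≡ true

IsPerfectMatching : {a b : ℕ} → WBipartite a b → EdgeSet a b → Set
IsPerfectMatching G M = IsMatching G M × CoversLeft M × CoversRight M

sumℤ : List ℤ → ℤ
sumℤ = foldr ℤ._+_ (ℤ.+ 0)

sumℕ : List ℕ → ℕ
sumℕ = foldr _+_ 0

weightOf : {a b : ℕ} → WBipartite a b → EdgeSet a b → ℤ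
weightOf {a} {b} G M =
  sumℤ (map (λ i → sumℤ (map (λ j → if M i j then weight G i j else ℤ.+ 0) (allFin b))) (allFin a))

sizeOf : {a b : ℕ} → EdgeSet a b → ℕ
sizeOf {a} {b} M =
  sumℕ (map (λ i → sumℕ (map (λ j → if M i j then 1 else 0) (allFin b))) (allFin a))

IsMinWeightPerfectMatching : {a b : ℕ} → WBipartite a b → EdgeSet a b → Set
IsMinWeightPerfectMatching G N =
  IsPerfectMatching G N × (∀ N' → IsPerfectMatching G N' → weightOf G N ℤ.≤ weightOf G N')

IsMaxCardMatching : {a b : ℕ} → WBipartite a b → EdgeSet a b → Set
IsMaxCardMatching G M =
  IsMatching G M × (∀ M' → IsMatching G M' → sizeOf M' ℕ.≤ sizeOf M)

IsOptimumMatching : {a b : ℕ} → WBipartite a b → EdgeSet a b → Set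
IsOptimumMatching G M =
  IsMaxCardMatching G M × (∀ M' → IsMaxCardMatching G M' → weightOf G M ℤ.≤ weightOf G M')

-- For G with U = Fin n, V = Fin s:
--   U_s = U ⊔ V'  encoded as Fin (n + s)  (first n: u_i, last s: v'_j)
--   V_s = V ⊔ U'  encoded as Fin (s + n)  (first s: v_j, last n: u'_i)
-- E_s = E ∪ E_f ∪ E_U with E_f = {v'_j u'_i : u_i v_j ∈ E}, E_U = {u_i u'_i}.
Gs : {n s : ℕ} → WBipartite n s → ℤ → WBipartite (n + s) (s + n)
Gs {n} {s} G k = record { edge = e ; weight = w }
  where
  e : Fin (n + s) → Fin (s + n) → Bool
  e x y with splitAt n x | splitAt s y
  ... | inj₁ i | inj₁ j  = edge G i j
  ... | inj₁ i | inj₂ i' = ⌊ i ≟ i' ⌋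
  ... | inj₂ j | inj₂ i  = edge G i j
  ... | inj₂ _ | inj₁ _  = false
  w : Fin (n + s) → Fin (s + n) → ℤ
  w x y with splitAt n x | splitAt s y
  ... | inj₁ i | inj₁ j  = weight G i j
  ... | inj₁ _ | inj₂ _  = k
  ... | inj₂ j | inj₂ i  = weight G i j
  ... | inj₂ _ | inj₁ _  = ℤ.+ 0

-- N ∩ E : the restriction of an edge set of G_s to the U × V block.
restrictE : (n s : ℕ) → EdgeSet (n + s) (s + n) → EdgeSet n s
restrictE n s N i j = N (i Data.Fin.↑ˡ s) (j Data.Fin.↑ˡ n)

-- A perfect matching P of G_s splits into its parts on E, E_U and E_f.  In G_s the
-- vertices of V are adjacent only to U, and those of V' only to U', so the E-part and
-- the E_f-part (read back in G) are matchings of G covering V; every u_i is matched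
-- either into V or to u'_i, so the E_U-part has n - s edges and weight k(n - s).
-- Conversely a matching X of G covering V extends to the perfect matching
-- X ∪ X' ∪ {u_i u'_i : u_i unmatched by X} of G_s, of weight 2 w(X) + k(n - s).
-- Minimality of N therefore gives w(M) + w(F) ≤ 2 w(X) for M = N ∩ E, F its E_f-part
-- and every such X: X = F yields w(M) ≤ w(F), hence 2 w(M) ≤ 2 w(X).  Finally a matching
-- of G has at most s edges, with equality exactly when it covers V, so the maximum
-- cardinality matchings of G are those covering V.

module Submission where

open import Defs
open import Data.Nat using (ℕ; zero; suc; _+_; _∸_; _≤_; _≥_; z≤n)
open import Data.Integer as ℤ using (ℤ; 0ℤ; +_)
open import Data.Product using (_×_; ∃; _,_; proj₁; proj₂)

open import Algebra.Bundles using (CommutativeMonoid)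
open import Data.Bool using (Bool; true; false; if_then_else_)
open import Data.Bool.Properties using (¬-not; not-¬)
import Data.Bool as Bool
open import Data.Empty using (⊥; ⊥-elim)
open import Data.Fin using (Fin; zero; suc; _↑ˡ_; _↑ʳ_; _≟_; splitAt; punchIn)
open import Data.Fin.Properties
  using (any?; ↑ˡ-injective; ↑ʳ-injective; splitAt-↑ˡ; splitAt-↑ʳ; punchInᵢ≢i)
import Data.Integer.Properties as ℤₚ
open import Data.List as List using (allFin)
open import Data.List.Properties using (map-tabulate)
import Data.Nat.Properties as ℕₚ
open import Data.Sum using (inj₁; inj₂)
open import Data.Vec.Functional using (Vector)
open import Function using (_∘_; id)
open import Relation.Binary.PropositionalEquality
  using (_≡_; _≢_; _≗_; refl; sym; trans; cong; cong₂; subst; subst₂; module ≡-Reasoning)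
open import Relation.Nullary using (Dec; yes; no; ¬_; contradiction)
open import Relation.Nullary.Decidable using (⌊_⌋; _×-dec_; ¬?)

module FinSum {c ℓ} (M : CommutativeMonoid c ℓ) where
  open CommutativeMonoid M
    using (_≈_; ∙-cong; ∙-congˡ; assoc; identityˡ; identityʳ)
    renaming (Carrier to A; _∙_ to _⊕_; ε to 0#; sym to ≈-sym; trans to ≈-trans; setoid to ≈-setoid)
  open import Algebra.Properties.CommutativeMonoid.Sum M public
  open import Relation.Binary.Reasoning.Setoid ≈-setoid

  foldr-allFin : ∀ n (f : Vector A n) → List.foldr _⊕_ 0# (List.map f (allFin n)) ≡ sum f
  foldr-allFin n f = trans (cong (List.foldr _⊕_ 0#) (map-tabulate id f)) (foldr-tabulate f)
    where
    foldr-tabulate : ∀ {m} (g : Vector A m) →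
                     List.foldr _⊕_ 0# (List.tabulate g) ≡ sum g
    foldr-tabulate {zero}  g = refl
    foldr-tabulate {suc m} g = cong (g zero ⊕_) (foldr-tabulate (g ∘ suc))

  sum-↑ : ∀ a {b} (f : Vector A (a + b)) → sum f ≈ sum (f ∘ (_↑ˡ b)) ⊕ sum (f ∘ (a ↑ʳ_))
  sum-↑ zero    f = ≈-sym (identityˡ _)
  sum-↑ (suc a) f = ≈-trans (∙-congˡ (sum-↑ a (f ∘ suc))) (≈-sym (assoc _ _ _))

  sum-blocks : ∀ a {b} c {d} (f : Fin (a + b) → Fin (c + d) → A) →
               ∑[ x < a + b ] ∑[ y < c + d ] f x y ≈
                 (∑[ i < a ] ∑[ j < c ] f (i ↑ˡ b) (j ↑ˡ d) ⊕ ∑[ i < a ] ∑[ j < d ] f (i ↑ˡ b) (c ↑ʳ j))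
               ⊕ (∑[ i < b ] ∑[ j < c ] f (a ↑ʳ i) (j ↑ˡ d) ⊕ ∑[ i < b ] ∑[ j < d ] f (a ↑ʳ i) (c ↑ʳ j))
  sum-blocks a {b} c {d} f = ≈-trans (sum-↑ a (λ x → ∑[ y < c + d ] f x y))
                                     (∙-cong (rows (f ∘ (_↑ˡ b))) (rows (f ∘ (a ↑ʳ_))))
    where
    rows : ∀ {m} (g : Fin m → Fin (c + d) → A) →
           ∑[ i < m ] ∑[ y < c + d ] g i y ≈
           ∑[ i < m ] ∑[ j < c ] g i (j ↑ˡ d) ⊕ ∑[ i < m ] ∑[ j < d ] g i (c ↑ʳ j)
    rows g = ≈-trans (sum-cong-≋ (λ i → sum-↑ c (g i)))
                     (∑-distrib-+ (λ i → ∑[ j < c ] g i (j ↑ˡ d)) (λ i → ∑[ j < d ] g i (c ↑ʳ j)))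

  sum-single : ∀ {n} (f : Vector A n) i → (∀ j → j ≢ i → f j ≈ 0#) → sum f ≈ f i
  sum-single {suc n} f i others = begin
    sum f                      ≈⟨ sum-remove {i = i} f ⟩
    f i ⊕ sum (f ∘ punchIn i)  ≈⟨ ∙-congˡ (sum-cong-≋ (λ j → others _ (punchInᵢ≢i i j))) ⟩
    f i ⊕ ∑[ j < n ] 0#        ≈⟨ ∙-congˡ (sum-replicate-zero n) ⟩
    f i ⊕ 0#                   ≈⟨ identityʳ _ ⟩
    f i                        ∎

data Split (a b : ℕ) : Fin (a + b) → Set where
  inˡ : (i : Fin a) → Split a b (i ↑ˡ b)
  inʳ : (j : Fin b) → Split a b (a ↑ʳ j)

split : ∀ a b x → Split a b x
split zero    b x       = inʳ x
split (suc a) b zero    = inˡ zero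
split (suc a) b (suc x) with split a b x
... | inˡ i = inˡ (suc i)
... | inʳ j = inʳ j

module Counting where
  open FinSum ℕₚ.+-0-commutativeMonoid

  𝟙 : Bool → ℕ
  𝟙 b = if b then 1 else 0

  count : ∀ {n} → Vector Bool n → ℕ
  count f = sum (𝟙 ∘ f)

  AtMostOne : ∀ {n} → Vector Bool n → Set
  AtMostOne f = ∀ i j → f i ≡ true → f j ≡ true → i ≡ j

  AtMostOne-≗ : ∀ {n} {f g : Vector Bool n} → f ≗ g → AtMostOne g → AtMostOne f
  AtMostOne-≗ f≗g unique i j fi fj = unique i j (trans (sym (f≗g i)) fi) (trans (sym (f≗g j)) fj)

  AtMostOne-↑ : ∀ {a b} {f : Vector Bool (a + b)} →
                AtMostOne (f ∘ (_↑ˡ b)) → AtMostOne (f ∘ (a ↑ʳ_)) →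
                (∀ i j → f (i ↑ˡ b) ≡ true → f (a ↑ʳ j) ≡ true → ⊥) → AtMostOne f
  AtMostOne-↑ {a} {b} uniqueˡ uniqueʳ disjoint x y fx fy with split a b x | split a b y
  ... | inˡ i | inˡ j = cong (_↑ˡ b) (uniqueˡ i j fx fy)
  ... | inˡ i | inʳ j = ⊥-elim (disjoint i j fx fy)
  ... | inʳ i | inˡ j = ⊥-elim (disjoint j i fy fx)
  ... | inʳ i | inʳ j = cong (a ↑ʳ_) (uniqueʳ i j fx fy)

  AtMostOne-↑ʳ : ∀ {a b} {f : Vector Bool (a + b)} →
                 (∀ i → f (i ↑ˡ b) ≡ false) → AtMostOne (f ∘ (a ↑ʳ_)) → AtMostOne f
  AtMostOne-↑ʳ none uniqueʳ =
    AtMostOne-↑ (λ i _ fi _ → ⊥-elim (not-¬ (none i) fi)) uniqueʳ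
                (λ i _ fi _ → not-¬ (none i) fi)

  AtMostOne-↑ˡ : ∀ {a b} {f : Vector Bool (a + b)} →
                 AtMostOne (f ∘ (_↑ˡ b)) → (∀ j → f (a ↑ʳ j) ≡ false) → AtMostOne f
  AtMostOne-↑ˡ uniqueˡ none =
    AtMostOne-↑ uniqueˡ (λ j _ fj _ → ⊥-elim (not-¬ (none j) fj))
                (λ _ j _ fj → not-¬ (none j) fj)

  count-none : ∀ {n} (f : Vector Bool n) → ¬ ∃ (λ i → f i ≡ true) → count f ≡ 0
  count-none {n} f none = trans (sum-cong-≗ {y = λ _ → 0} 𝟙∘f≗0) (sum-replicate-zero n)
    where
    𝟙∘f≗0 : ∀ i → 𝟙 (f i) ≡ 0
    𝟙∘f≗0 i = cong 𝟙 (¬-not (λ fi → none (i , fi)))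

  count-unique : ∀ {n} (f : Vector Bool n) {i} → AtMostOne f → f i ≡ true → count f ≡ 1
  count-unique f {i} unique fi = trans (sum-single (𝟙 ∘ f) i others) (cong 𝟙 fi)
    where
    others : ∀ j → j ≢ i → 𝟙 (f j) ≡ 0
    others j j≢i = cong 𝟙 (¬-not (λ fj → j≢i (unique j i fj fi)))

  count≤1 : ∀ {n} (f : Vector Bool n) → AtMostOne f → count f ≤ 1
  count≤1 f unique with any? (λ i → f i Bool.≟ true)
  ... | yes (i , fi) = ℕₚ.≤-reflexive (count-unique f unique fi)
  ... | no none      = ℕₚ.≤-trans (ℕₚ.≤-reflexive (count-none f none)) z≤n

  count-pos : ∀ {n} (f : Vector Bool n) → 1 ≤ count f → ∃ λ i → f i ≡ true
  count-pos f pos with any? (λ i → f i Bool.≟ true)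
  ... | yes found = found
  ... | no none   = contradiction (subst (1 ≤_) (count-none f none) pos) λ ()

  sum-ones : ∀ n → ∑[ i < n ] 1 ≡ n
  sum-ones zero    = refl
  sum-ones (suc n) = cong suc (sum-ones n)

  sum≤n : ∀ {n} (f : Vector ℕ n) → (∀ i → f i ≤ 1) → sum f ≤ n
  sum≤n {zero}  f f≤1 = z≤n
  sum≤n {suc n} f f≤1 = ℕₚ.+-mono-≤ (f≤1 zero) (sum≤n (f ∘ suc) (f≤1 ∘ suc))

  sum≥n⇒1≤ : ∀ {n} (f : Vector ℕ n) → (∀ i → f i ≤ 1) → n ≤ sum f → ∀ i → 1 ≤ f i
  sum≥n⇒1≤ {suc n} f f≤1 n≤∑f i = ℕₚ.+-cancelʳ-≤ n 1 (f i) (begin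
    suc n                      ≤⟨ n≤∑f ⟩
    sum f                      ≡⟨ sum-remove {i = i} f ⟩
    f i + sum (f ∘ punchIn i)  ≤⟨ ℕₚ.+-monoʳ-≤ (f i) (sum≤n _ (f≤1 ∘ punchIn i)) ⟩
    f i + n                    ∎)
    where open ℕₚ.≤-Reasoning

open Counting

module Sizes where
  open FinSum ℕₚ.+-0-commutativeMonoid

  _ᵀ : ∀ {a b} → EdgeSet a b → EdgeSet b a
  (X ᵀ) j i = X i j

  sizeOf-∑ : ∀ {a b} (X : EdgeSet a b) → sizeOf X ≡ ∑[ i < a ] count (X i)
  sizeOf-∑ {a} {b} X = trans (foldr-allFin a _) (sum-cong-≗ (λ i → foldr-allFin b (𝟙 ∘ X i)))

  sizeOf-ᵀ : ∀ {a b} (X : EdgeSet a b) → sizeOf (X ᵀ) ≡ sizeOf X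
  sizeOf-ᵀ X = trans (sizeOf-∑ (X ᵀ))
                     (trans (sym (∑-comm (λ i j → 𝟙 (X i j)))) (sym (sizeOf-∑ X)))

  sizeOf-↑ : ∀ {a} c {d} (X : EdgeSet a (c + d)) →
             sizeOf X ≡ sizeOf (λ i j → X i (j ↑ˡ d)) + sizeOf (λ i j → X i (c ↑ʳ j))
  sizeOf-↑ {a} c {d} X = begin
    sizeOf X
      ≡⟨ sizeOf-∑ X ⟩
    ∑[ i < a ] count (X i)
      ≡⟨ sum-cong-≗ (λ i → sum-↑ c (𝟙 ∘ X i)) ⟩
    ∑[ i < a ] (count (X i ∘ (_↑ˡ d)) + count (X i ∘ (c ↑ʳ_)))
      ≡⟨ ∑-distrib-+ (λ i → count (X i ∘ (_↑ˡ d))) _ ⟩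
    ∑[ i < a ] count (X i ∘ (_↑ˡ d)) + ∑[ i < a ] count (X i ∘ (c ↑ʳ_))
      ≡⟨ sym (cong₂ _+_ (sizeOf-∑ (λ i j → X i (j ↑ˡ d))) (sizeOf-∑ (λ i j → X i (c ↑ʳ j)))) ⟩
    sizeOf (λ i j → X i (j ↑ˡ d)) + sizeOf (λ i j → X i (c ↑ʳ j))
      ∎
    where open ≡-Reasoning

  module _ {a b} {X : EdgeSet a b} (unique : ∀ i → AtMostOne (X i)) where

    sizeOf≤ : sizeOf X ≤ a
    sizeOf≤ = subst (_≤ a) (sym (sizeOf-∑ X)) (sum≤n _ (λ i → count≤1 (X i) (unique i)))

    sizeOf-coversLeft : CoversLeft X → sizeOf X ≡ a
    sizeOf-coversLeft covers = begin
      sizeOf X                 ≡⟨ sizeOf-∑ X ⟩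
      ∑[ i < a ] count (X i)   ≡⟨ sum-cong-≗ (λ i → count-unique _ (unique i) (proj₂ (covers i))) ⟩
      ∑[ i < a ] 1             ≡⟨ sum-ones a ⟩
      a                        ∎
      where open ≡-Reasoning

    coversLeft-of-sizeOf : a ≤ sizeOf X → CoversLeft X
    coversLeft-of-sizeOf a≤size i =
      count-pos (X i) (sum≥n⇒1≤ _ (λ i → count≤1 (X i) (unique i)) (subst (a ≤_) (sizeOf-∑ X) a≤size) i)

  module _ {a b} {G : WBipartite a b} {X : EdgeSet a b} (matching : IsMatching G X) where

    columnsAtMostOne : ∀ j → AtMostOne ((X ᵀ) j)
    columnsAtMostOne j i i' = IsMatching.uniqR matching i i' j

    sizeOf-matching≤ : sizeOf X ≤ b
    sizeOf-matching≤ = subst (_≤ b) (sizeOf-ᵀ X) (sizeOf≤ columnsAtMostOne)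

    sizeOf-coversRight : CoversRight X → sizeOf X ≡ b
    sizeOf-coversRight covers = trans (sym (sizeOf-ᵀ X)) (sizeOf-coversLeft columnsAtMostOne covers)

    coversRight-of-sizeOf : b ≤ sizeOf X → CoversRight X
    coversRight-of-sizeOf b≤size =
      coversLeft-of-sizeOf columnsAtMostOne (subst (b ≤_) (sym (sizeOf-ᵀ X)) b≤size)

open Sizes

module Weights where
  open FinSum ℤₚ.+-0-commutativeMonoid
  open FinSum ℕₚ.+-0-commutativeMonoid using () renaming (sum to ∑ℕ)

  weightOn : ∀ {a b} → WBipartite a b → EdgeSet a b → Fin a → Fin b → ℤ
  weightOn G X i j = if X i j then weight G i j else 0ℤ

  weightOf-∑ : ∀ {a b} (G : WBipartite a b) (X : EdgeSet a b) →
               weightOf G X ≡ ∑[ i < a ] ∑[ j < b ] weightOn G X i j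
  weightOf-∑ {a} {b} G X =
    trans (foldr-allFin a _) (sum-cong-≗ (λ i → foldr-allFin b (weightOn G X i)))

  weightOf-cong : ∀ {a b} (G : WBipartite a b) {X Y : EdgeSet a b} →
                  (∀ i j → X i j ≡ Y i j) → weightOf G X ≡ weightOf G Y
  weightOf-cong {a} G {X} {Y} X≗Y = begin
    weightOf G X                     ≡⟨ weightOf-∑ G X ⟩
    ∑[ i < a ] sum (weightOn G X i)
      ≡⟨ sum-cong-≗ (λ i → sum-cong-≗ (λ j → cong (λ b → if b then weight G i j else 0ℤ) (X≗Y i j))) ⟩
    ∑[ i < a ] sum (weightOn G Y i)  ≡⟨ sym (weightOf-∑ G Y) ⟩
    weightOf G Y                     ∎
    where open ≡-Reasoning

  sum-homomorphic : (h : ℕ → ℤ) → h 0 ≡ 0ℤ → (∀ m n → h (m + n) ≡ h m ℤ.+ h n) →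
                    ∀ {n} (f : Vector ℕ n) → sum (h ∘ f) ≡ h (∑ℕ f)
  sum-homomorphic h h0 h+ {zero}  f = sym h0
  sum-homomorphic h h0 h+ {suc n} f =
    trans (cong (ℤ._+_ (h (f zero))) (sum-homomorphic h h0 h+ (f ∘ suc))) (sym (h+ (f zero) _))

  sum-if-const : ∀ {a b} (k : ℤ) (X : EdgeSet a b) →
                 ∑[ i < a ] ∑[ j < b ] (if X i j then k else 0ℤ) ≡ k ℤ.* + sizeOf X
  sum-if-const {a} {b} k X = begin
    ∑[ i < a ] ∑[ j < b ] (if X i j then k else 0ℤ)
      ≡⟨ sum-cong-≗ (λ i → sum-cong-≗ (λ j → if-k≡k* (X i j))) ⟩
    ∑[ i < a ] ∑[ j < b ] k* (𝟙 (X i j))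
      ≡⟨ sum-cong-≗ (λ i → sum-homomorphic k* k*0 k*+ (𝟙 ∘ X i)) ⟩
    ∑[ i < a ] k* (count (X i))
      ≡⟨ sum-homomorphic k* k*0 k*+ (count ∘ X) ⟩
    k* (∑ℕ (count ∘ X))
      ≡⟨ cong k* (sym (sizeOf-∑ X)) ⟩
    k* (sizeOf X)
      ∎
    where
    open ≡-Reasoning
    k* : ℕ → ℤ
    k* m = k ℤ.* + m
    k*0 : k* 0 ≡ 0ℤ
    k*0 = ℤₚ.*-zeroʳ k
    k*+ : ∀ m n → k* (m + n) ≡ k* m ℤ.+ k* n
    k*+ m n = trans (cong (k ℤ.*_) (ℤₚ.pos-+ m n)) (ℤₚ.*-distribˡ-+ k (+ m) (+ n))
    if-k≡k* : ∀ b → (if b then k else 0ℤ) ≡ k* (𝟙 b)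
    if-k≡k* true  = sym (ℤₚ.*-identityʳ k)
    if-k≡k* false = sym (ℤₚ.*-zeroʳ k)

open Weights

isYes⁺ : ∀ {p} {P : Set p} (p? : Dec P) → P → ⌊ p? ⌋ ≡ true
isYes⁺ (yes _) _  = refl
isYes⁺ (no ¬p) p  = contradiction p ¬p

isYes⁻ : ∀ {p} {P : Set p} (p? : Dec P) → ⌊ p? ⌋ ≡ true → P
isYes⁻ (yes p) _ = p

restrictEU : (n s : ℕ) → EdgeSet (n + s) (s + n) → EdgeSet n n
restrictEU n s P i i' = P (i ↑ˡ s) (s ↑ʳ i')

restrictEf : (n s : ℕ) → EdgeSet (n + s) (s + n) → EdgeSet n s
restrictEf n s P i j = P (n ↑ʳ j) (s ↑ʳ i)

Unmatched : ∀ {a b} → EdgeSet a b → Fin a → Set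
Unmatched X i = ¬ ∃ λ j → X i j ≡ true

unmatched? : ∀ {a b} (X : EdgeSet a b) i → Dec (Unmatched X i)
unmatched? X i = ¬? (any? λ j → X i j Bool.≟ true)

extend : ∀ {n s} → EdgeSet n s → EdgeSet (n + s) (s + n)
extend {n} {s} X x y with splitAt n x | splitAt s y
... | inj₁ i | inj₁ j  = X i j
... | inj₁ i | inj₂ i' = ⌊ (i ≟ i') ×-dec unmatched? X i ⌋
... | inj₂ j | inj₂ i  = X i j
... | inj₂ _ | inj₁ _  = false

module _ {n s : ℕ} (X : EdgeSet n s) where

  extend-E : ∀ i j → extend X (i ↑ˡ s) (j ↑ˡ n) ≡ X i j
  extend-E i j rewrite splitAt-↑ˡ n i s | splitAt-↑ˡ s j n = refl

  extend-EU : ∀ i i' → extend X (i ↑ˡ s) (s ↑ʳ i') ≡ ⌊ (i ≟ i') ×-dec unmatched? X i ⌋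
  extend-EU i i' rewrite splitAt-↑ˡ n i s | splitAt-↑ʳ s n i' = refl

  extend-V'V : ∀ j j' → extend X (n ↑ʳ j) (j' ↑ˡ n) ≡ false
  extend-V'V j j' rewrite splitAt-↑ʳ n s j | splitAt-↑ˡ s j' n = refl

  extend-Ef : ∀ j i → extend X (n ↑ʳ j) (s ↑ʳ i) ≡ X i j
  extend-Ef j i rewrite splitAt-↑ʳ n s j | splitAt-↑ʳ s n i = refl

  extend-EU-true : ∀ {i i'} → extend X (i ↑ˡ s) (s ↑ʳ i') ≡ true → i ≡ i' × Unmatched X i
  extend-EU-true {i} {i'} h = isYes⁻ ((i ≟ i') ×-dec unmatched? X i) (trans (sym (extend-EU i i')) h)

  extend-EU-of-unmatched : ∀ {i} → Unmatched X i → extend X (i ↑ˡ s) (s ↑ʳ i) ≡ true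
  extend-EU-of-unmatched {i} unmatched =
    trans (extend-EU i i) (isYes⁺ ((i ≟ i) ×-dec unmatched? X i) (refl , unmatched))

module _ {n s : ℕ} (G : WBipartite n s) (k : ℤ) where

  Gs-edge-E : ∀ i j → edge (Gs G k) (i ↑ˡ s) (j ↑ˡ n) ≡ edge G i j
  Gs-edge-E i j rewrite splitAt-↑ˡ n i s | splitAt-↑ˡ s j n = refl

  Gs-edge-EU : ∀ i i' → edge (Gs G k) (i ↑ˡ s) (s ↑ʳ i') ≡ ⌊ i ≟ i' ⌋
  Gs-edge-EU i i' rewrite splitAt-↑ˡ n i s | splitAt-↑ʳ s n i' = refl

  Gs-edge-V'V : ∀ j j' → edge (Gs G k) (n ↑ʳ j) (j' ↑ˡ n) ≡ false
  Gs-edge-V'V j j' rewrite splitAt-↑ʳ n s j | splitAt-↑ˡ s j' n = refl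

  Gs-edge-Ef : ∀ j i → edge (Gs G k) (n ↑ʳ j) (s ↑ʳ i) ≡ edge G i j
  Gs-edge-Ef j i rewrite splitAt-↑ʳ n s j | splitAt-↑ʳ s n i = refl

  Gs-weight-E : ∀ i j → weight (Gs G k) (i ↑ˡ s) (j ↑ˡ n) ≡ weight G i j
  Gs-weight-E i j rewrite splitAt-↑ˡ n i s | splitAt-↑ˡ s j n = refl

  Gs-weight-EU : ∀ i i' → weight (Gs G k) (i ↑ˡ s) (s ↑ʳ i') ≡ k
  Gs-weight-EU i i' rewrite splitAt-↑ˡ n i s | splitAt-↑ʳ s n i' = refl

  Gs-weight-V'V : ∀ j j' → weight (Gs G k) (n ↑ʳ j) (j' ↑ˡ n) ≡ 0ℤ
  Gs-weight-V'V j j' rewrite splitAt-↑ʳ n s j | splitAt-↑ˡ s j' n = refl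

  Gs-weight-Ef : ∀ j i → weight (Gs G k) (n ↑ʳ j) (s ↑ʳ i) ≡ weight G i j
  Gs-weight-Ef j i rewrite splitAt-↑ʳ n s j | splitAt-↑ʳ s n i = refl

  module _ {P : EdgeSet (n + s) (s + n)} (perfect : IsPerfectMatching (Gs G k) P) where
    open IsMatching (proj₁ perfect)

    private
      coversUs : CoversLeft P
      coversUs = proj₁ (proj₂ perfect)
      coversVs : CoversRight P
      coversVs = proj₂ (proj₂ perfect)

    restrictE-matching : IsMatching G (restrictE n s P)
    restrictE-matching = record
      { subset = λ i j h → trans (sym (Gs-edge-E i j)) (subset _ _ h)
      ; uniqL  = λ i j j' h h' → ↑ˡ-injective n j j' (uniqL _ _ _ h h')
      ; uniqR  = λ i i' j h h' → ↑ˡ-injective s i i' (uniqR _ _ _ h h')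
      }

    restrictEf-matching : IsMatching G (restrictEf n s P)
    restrictEf-matching = record
      { subset = λ i j h → trans (sym (Gs-edge-Ef j i)) (subset _ _ h)
      ; uniqL  = λ i j j' h h' → ↑ʳ-injective n j j' (uniqR _ _ _ h h')
      ; uniqR  = λ i i' j h h' → ↑ʳ-injective s i i' (uniqL _ _ _ h h')
      }

    restrictE-coversRight : CoversRight (restrictE n s P)
    restrictE-coversRight j with coversVs (j ↑ˡ n)
    ... | x , h with split n s x
    ...   | inˡ i  = i , h
    ...   | inʳ j' = ⊥-elim (not-¬ (Gs-edge-V'V j' j) (subset _ _ h))

    restrictEf-coversRight : CoversRight (restrictEf n s P)
    restrictEf-coversRight j with coversUs (n ↑ʳ j)
    ... | y , h with split s n y
    ...   | inˡ j' = ⊥-elim (not-¬ (Gs-edge-V'V j j') (subset _ _ h))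
    ...   | inʳ i  = i , h

    sizeOf-restrictEU : sizeOf (restrictEU n s P) ≡ n ∸ s
    sizeOf-restrictEU = begin
      sizeOf EU                 ≡⟨ sym (ℕₚ.m+n∸m≡n s _) ⟩
      s + sizeOf EU ∸ s         ≡⟨ cong (λ m → m + sizeOf EU ∸ s) (sym sizeOf-E) ⟩
      sizeOf E + sizeOf EU ∸ s  ≡⟨ cong (_∸ s) (sym (sizeOf-↑ s topRows)) ⟩
      sizeOf topRows ∸ s        ≡⟨ cong (_∸ s) sizeOf-topRows ⟩
      n ∸ s                     ∎
      where
      open ≡-Reasoning
      E EU : EdgeSet n _
      E  = restrictE n s P
      EU = restrictEU n s P
      topRows : EdgeSet n (s + n)
      topRows i = P (i ↑ˡ s)
      sizeOf-topRows : sizeOf topRows ≡ n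
      sizeOf-topRows = sizeOf-coversLeft (λ i → uniqL (i ↑ˡ s)) (λ i → coversUs (i ↑ˡ s))
      sizeOf-E : sizeOf E ≡ s
      sizeOf-E = sizeOf-coversRight restrictE-matching restrictE-coversRight

    weightOf-perfect : weightOf (Gs G k) P ≡
                       (weightOf G (restrictE n s P) ℤ.+ weightOf G (restrictEf n s P)) ℤ.+ k ℤ.* + (n ∸ s)
    weightOf-perfect = begin
      weightOf (Gs G k) P
        ≡⟨ weightOf-∑ (Gs G k) P ⟩
      ∑[ x < n + s ] ∑[ y < s + n ] weightOn (Gs G k) P x y
        ≡⟨ sum-blocks n s (weightOn (Gs G k) P) ⟩
      (wE ℤ.+ wEU) ℤ.+ (wV'V ℤ.+ wEf)
        ≡⟨ cong₂ ℤ._+_ (cong₂ ℤ._+_ E-block EU-block) (cong₂ ℤ._+_ V'V-block Ef-block) ⟩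
      (wM ℤ.+ K) ℤ.+ (0ℤ ℤ.+ wF)
        ≡⟨ cong (ℤ._+_ (wM ℤ.+ K)) (ℤₚ.+-identityˡ wF) ⟩
      (wM ℤ.+ K) ℤ.+ wF
        ≡⟨ xy∙z≈xz∙y wM K wF ⟩
      (wM ℤ.+ wF) ℤ.+ K
        ∎
      where
      open ≡-Reasoning
      open FinSum ℤₚ.+-0-commutativeMonoid
      open import Algebra.Properties.CommutativeSemigroup ℤₚ.+-commutativeSemigroup using (xy∙z≈xz∙y)
      reweigh : ∀ {x y w} → weight (Gs G k) x y ≡ w →
                weightOn (Gs G k) P x y ≡ (if P x y then w else 0ℤ)
      reweigh {x} {y} = cong (λ w → if P x y then w else 0ℤ)
      wM wF K wE wEU wV'V wEf : ℤ
      wM   = weightOf G (restrictE n s P)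
      wF   = weightOf G (restrictEf n s P)
      K    = k ℤ.* + (n ∸ s)
      wE   = ∑[ i < n ] ∑[ j < s ] weightOn (Gs G k) P (i ↑ˡ s) (j ↑ˡ n)
      wEU  = ∑[ i < n ] ∑[ i' < n ] weightOn (Gs G k) P (i ↑ˡ s) (s ↑ʳ i')
      wV'V = ∑[ j < s ] ∑[ j' < s ] weightOn (Gs G k) P (n ↑ʳ j) (j' ↑ˡ n)
      wEf  = ∑[ j < s ] ∑[ i < n ] weightOn (Gs G k) P (n ↑ʳ j) (s ↑ʳ i)
      E-block : wE ≡ wM
      E-block = trans (sum-cong-≗ λ i → sum-cong-≗ λ j → reweigh (Gs-weight-E i j))
                      (sym (weightOf-∑ G _))
      EU-block : wEU ≡ K
      EU-block = trans (sum-cong-≗ λ i → sum-cong-≗ λ i' → reweigh (Gs-weight-EU i i'))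
                       (trans (sum-if-const k (restrictEU n s P)) (cong (λ m → k ℤ.* + m) sizeOf-restrictEU))
      V'V-block : wV'V ≡ 0ℤ
      V'V-block = trans (sum-cong-≗ λ j → sum-cong-≗ λ j' → reweigh (Gs-weight-V'V j j'))
                        (sum-if-const 0ℤ (λ j j' → P (n ↑ʳ j) (j' ↑ˡ n)))
      Ef-block : wEf ≡ wF
      Ef-block = trans (sum-cong-≗ λ j → sum-cong-≗ λ i → reweigh (Gs-weight-Ef j i))
                       (trans (sym (∑-comm (weightOn G (restrictEf n s P)))) (sym (weightOf-∑ G _)))

  module _ {X : EdgeSet n s} (matching : IsMatching G X) (coversV : CoversRight X) where
    open IsMatching matching

    extend-matching : IsMatching (Gs G k) (extend X)
    extend-matching = record { subset = subset′ ; uniqL = uniqL′ ; uniqR = λ x x' y → uniqR′ y x x' }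
      where
      diagonal : ∀ {i i'} → extend X (i ↑ˡ s) (s ↑ʳ i') ≡ true → i ≡ i'
      diagonal h = proj₁ (extend-EU-true X h)

      subset′ : ∀ x y → extend X x y ≡ true → edge (Gs G k) x y ≡ true
      subset′ x y h with split n s x | split s n y
      ... | inˡ i | inˡ j  = trans (Gs-edge-E i j) (subset i j (trans (sym (extend-E X i j)) h))
      ... | inˡ i | inʳ i' = trans (Gs-edge-EU i i') (isYes⁺ (i ≟ i') (diagonal h))
      ... | inʳ j | inˡ j' = ⊥-elim (not-¬ (extend-V'V X j j') h)
      ... | inʳ j | inʳ i  = trans (Gs-edge-Ef j i) (subset i j (trans (sym (extend-Ef X j i)) h))

      uniqL′ : ∀ x → AtMostOne (extend X x)
      uniqL′ x with split n s x
      ... | inˡ i = AtMostOne-↑ (AtMostOne-≗ (extend-E X i) (uniqL i))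
                                (λ _ _ h h' → trans (sym (diagonal h)) (diagonal h'))
                                (λ j _ hE hEU → proj₂ (extend-EU-true X hEU) (j , trans (sym (extend-E X i j)) hE))
      ... | inʳ j = AtMostOne-↑ʳ (extend-V'V X j)
                                 (AtMostOne-≗ (extend-Ef X j) (λ i i' → uniqR i i' j))

      uniqR′ : ∀ y → AtMostOne (λ x → extend X x y)
      uniqR′ y with split s n y
      ... | inˡ j = AtMostOne-↑ˡ (AtMostOne-≗ (λ i → extend-E X i j) (λ i i' → uniqR i i' j))
                                 (λ j' → extend-V'V X j' j)
      ... | inʳ i = AtMostOne-↑ (λ _ _ h h' → trans (diagonal h) (sym (diagonal h')))
                                (AtMostOne-≗ (λ j → extend-Ef X j i) (uniqL i))
                                disjoint
        where
        disjoint : ∀ i₁ j → extend X (i₁ ↑ˡ s) (s ↑ʳ i) ≡ true →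
                   extend X (n ↑ʳ j) (s ↑ʳ i) ≡ true → ⊥
        disjoint i₁ j hEU hEf with extend-EU-true X hEU
        ... | refl , unmatched = unmatched (j , trans (sym (extend-Ef X j i)) hEf)

    extend-coversLeft : CoversLeft (extend X)
    extend-coversLeft x with split n s x
    ... | inʳ j = let (i , h) = coversV j in s ↑ʳ i , trans (extend-Ef X j i) h
    ... | inˡ i with any? (λ j → X i j Bool.≟ true)
    ...   | yes (j , h)  = j ↑ˡ n , trans (extend-E X i j) h
    ...   | no unmatched = s ↑ʳ i , extend-EU-of-unmatched X unmatched

    extend-coversRight : CoversRight (extend X)
    extend-coversRight y with split s n y
    ... | inˡ j = let (i , h) = coversV j in i ↑ˡ s , trans (extend-E X i j) h
    ... | inʳ i with any? (λ j → X i j Bool.≟ true)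
    ...   | yes (j , h)  = n ↑ʳ j , trans (extend-Ef X j i) h
    ...   | no unmatched = i ↑ˡ s , extend-EU-of-unmatched X unmatched

    extend-perfect : IsPerfectMatching (Gs G k) (extend X)
    extend-perfect = extend-matching , extend-coversLeft , extend-coversRight

    weightOf-extend : weightOf (Gs G k) (extend X) ≡
                      (weightOf G X ℤ.+ weightOf G X) ℤ.+ k ℤ.* + (n ∸ s)
    weightOf-extend = trans (weightOf-perfect extend-perfect)
      (cong (ℤ._+ k ℤ.* + (n ∸ s))
            (cong₂ ℤ._+_ (weightOf-cong G (extend-E X)) (weightOf-cong G (λ i j → extend-Ef X j i))))

≤-reflected : {f : ℤ → ℤ} → (∀ {x y} → x ℤ.< y → f x ℤ.< f y) →
              ∀ {x y} → f x ℤ.≤ f y → x ℤ.≤ y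
≤-reflected f-mono {x} {y} fx≤fy with x ℤ.≤? y
... | yes x≤y = x≤y
... | no x≰y  = contradiction fx≤fy (ℤₚ.<⇒≱ (f-mono (ℤₚ.≰⇒> x≰y)))

mainTheorem13 : (n s : ℕ) → n ≥ s → (G : WBipartite n s) → (k : ℤ)
    → (N : EdgeSet (n + s) (s + n))
    → IsMinWeightPerfectMatching (Gs G k) N
    → IsOptimumMatching G (restrictE n s N) × CoversRight (restrictE n s N)
mainTheorem13 n s _ G k N (perfect , minimal) = ((M-matching , M-maximum) , M-optimal) , M-coversV
  where
  M F : EdgeSet n s
  M = restrictE n s N
  F = restrictEf n s N

  M-matching : IsMatching G M
  M-matching = restrictE-matching G k perfect

  M-coversV : CoversRight M
  M-coversV = restrictE-coversRight G k perfect

  sizeOf-M : sizeOf M ≡ s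
  sizeOf-M = sizeOf-coversRight M-matching M-coversV

  M-maximum : ∀ M' → IsMatching G M' → sizeOf M' ≤ sizeOf M
  M-maximum M' matching' = subst (sizeOf M' ≤_) (sym sizeOf-M) (sizeOf-matching≤ matching')

  M+F≤X+X : ∀ X → IsMatching G X → CoversRight X →
            weightOf G M ℤ.+ weightOf G F ℤ.≤ weightOf G X ℤ.+ weightOf G X
  M+F≤X+X X matching coversV = ≤-reflected (ℤₚ.+-monoˡ-< (k ℤ.* + (n ∸ s)))
    (subst₂ ℤ._≤_ (weightOf-perfect G k perfect) (weightOf-extend G k matching coversV)
            (minimal (extend X) (extend-perfect G k matching coversV)))

  M≤F : weightOf G M ℤ.≤ weightOf G F
  M≤F = ≤-reflected (ℤₚ.+-monoˡ-< (weightOf G F))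
          (M+F≤X+X F (restrictEf-matching G k perfect) (restrictEf-coversRight G k perfect))

  M-optimal : ∀ M' → IsMaxCardMatching G M' → weightOf G M ℤ.≤ weightOf G M'
  M-optimal M' (matching' , maximum') = ≤-reflected (λ x<y → ℤₚ.+-mono-< x<y x<y)
    (ℤₚ.≤-trans (ℤₚ.+-monoʳ-≤ (weightOf G M) M≤F) (M+F≤X+X M' matching' coversV'))
    where
    coversV' : CoversRight M'
    coversV' = coversRight-of-sizeOf matching' (subst (_≤ sizeOf M') sizeOf-M (maximum' M M-matching))
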